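{- Let $k,k'$ be integers with $k\equiv k'\bmod p^n(p-1)$ and let $f_k$, $f_{k'}$ be algebraic nearly holomorphic modular forms of weights $k$, $k'$ such that $f_k\equiv f_{k'}\bmod p^m$. Then $\delta_kf_k\equiv\delta_{k'}f_{k'}\bmod p^{\min(n,m)}$.
   Context: $p$ prime. Nearly holomorphic modular forms are identified with their polynomial $q$-expansions $\sum_i f_i(q)X^i$ (with $X$ corresponding to $-1/(4\pi y)$), and congruences modulo $p^m$ are congruences between $p$-integral coefficients of these polynomial $q$-expansions. $\delta_k$ is the Maass–Shimura operator, acting on polynomial $q$-expansions by $\sum_if_iX^i\mapsto\sum_i(\Theta f_iX^i+(k-i)f_iX^{i+1})$ with $\Theta=q\,d/dq$. -}

module Defs where

open import Level using (Level; _⊔_)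
open import Algebra.Bundles using (CommutativeRing)
open import Data.Nat as ℕ using (ℕ; zero; suc; _^_; _≤_)
open import Data.Integer as ℤ using (ℤ; +_; -[1+_])
open import Data.Product using (∃)

module _ {c ℓ : Level} (R : CommutativeRing c ℓ) where
  open CommutativeRing R hiding (zero)

  ℕ→R : ℕ → Carrier
  ℕ→R zero    = 0#
  ℕ→R (suc n) = 1# + ℕ→R n

  ℤ→R : ℤ → Carrier
  ℤ→R (+ n)      = ℕ→R n
  ℤ→R -[1+ n ]   = - ℕ→R (suc n)

  -- a (formal) polynomial q-expansion  Σ_i f_i(q) X^i  with coefficients in R:
  -- f i j is the coefficient of X^i q^j
  QExp : Set c
  QExp = ℕ → ℕ → Carrier

  IsPolynomialInX : QExp → Set ℓ
  IsPolynomialInX f = ∃ λ N → ∀ i → N ≤ i → ∀ j → f i j ≈ 0#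

  -- Θ = q d/dq on a q-expansion
  Θ : (ℕ → Carrier) → ℕ → Carrier
  Θ g j = ℕ→R j * g j

  -- Maass–Shimura operator δ_k : Σ f_i X^i ↦ Σ (Θ f_i X^i + (k - i) f_i X^{i+1})
  δ : ℤ → QExp → QExp
  δ k f zero    j = Θ (f zero) j
  δ k f (suc i) j = Θ (f (suc i)) j + ℤ→R (k ℤ.- + i) * f i j

  CongMod : ℕ → ℕ → QExp → QExp → Set (c ⊔ ℓ)
  CongMod p m f g = ∀ i j → ∃ λ h → f i j - g i j ≈ ℕ→R (p ^ m) * h

{-# OPTIONS --safe #-}
module Submission where

open import Defs
open import Level using (Level; _⊔_)
open import Algebra.Bundles using (CommutativeRing)
open import Data.Nat as ℕ using (ℕ; _^_; _∸_; _⊓_)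
open import Data.Nat.Primality using (Prime)
open import Data.Integer as ℤ using (ℤ; +_)
open import Data.Integer.Divisibility using (_∣_)

open import Data.Product using (∃; _,_)
open import Data.Nat.Divisibility as ℕ∣ using (divides)
import Data.Nat.Properties as ℕ
import Data.Integer.Properties as ℤ
import Relation.Binary.PropositionalEquality as ≡
import Algebra.Solver.Ring.NaturalCoefficients.Default as SemiringSolver
import Algebra.Properties.Ring as RingProperties
import Algebra.Properties.Semiring.Mult as SemiringMult
import Relation.Binary.Reasoning.Setoid as SetoidReasoning

-- Writing δ_k f coefficientwise, (δ_k f)_{i,j} = j f_{i,j} + (k - i + 1) f_{i-1,j}
-- is a polynomial in the coefficients of f and in k, so it respects any congruence
-- modulo Q satisfied by both f and k.  Here Q = p^min(n,m) divides p^m and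
-- p^n (p - 1).

m≤n⇒o^m∣o^n : ∀ o {m n} → m ℕ.≤ n → o ^ m ℕ∣.∣ o ^ n
m≤n⇒o^m∣o^n o {m} {n} m≤n = divides (o ^ (n ∸ m)) (begin
  o ^ n                  ≡⟨ ≡.cong (o ^_) (ℕ.m∸n+n≡m m≤n) ⟨
  o ^ (n ∸ m ℕ.+ m)      ≡⟨ ℕ.^-distribˡ-+-* o (n ∸ m) m ⟩
  o ^ (n ∸ m) ℕ.* o ^ m  ∎)
  where open ≡.≡-Reasoning

module _ {c ℓ : Level} (R : CommutativeRing c ℓ) where
  open CommutativeRing R hiding (zero)
  open RingProperties ring
    using (-0#≈0#; -‿involutive; -‿distribʳ-*; -‿+-comm; xyx⁻¹≈y; //-rightDividesˡ; //-rightDividesʳ)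
  open SemiringMult semiring using (_×_; ×-homo-+; ×1-homo-*)
  open SemiringSolver commutativeSemiring using (solve; _:+_; _:*_; _:=_)
  open SetoidReasoning setoid

  infix 4 _≡_mod_
  _≡_mod_ : Carrier → Carrier → Carrier → Set (c ⊔ ℓ)
  a ≡ b mod Q = ∃ λ h → a - b ≈ Q * h

  x≈y+z⇒x-y≈z : ∀ {x y z} → x ≈ y + z → x - y ≈ z
  x≈y+z⇒x-y≈z {x} {y} {z} x≈y+z = begin
    x - y        ≈⟨ +-congʳ (trans x≈y+z (+-comm y z)) ⟩
    (z + y) - y  ≈⟨ //-rightDividesʳ y z ⟩
    z            ∎

  x-y≈z⇒x≈y+z : ∀ {x y z} → x - y ≈ z → x ≈ y + z
  x-y≈z⇒x≈y+z {x} {y} {z} x-y≈z = begin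
    x            ≈⟨ //-rightDividesˡ y x ⟨
    (x - y) + y  ≈⟨ +-congʳ x-y≈z ⟩
    z + y        ≈⟨ +-comm z y ⟩
    y + z        ∎

  ≡-mod-refl : ∀ {a Q} → a ≡ a mod Q
  ≡-mod-refl {a} {Q} = 0# , trans (-‿inverseʳ a) (sym (zeroʳ Q))

  ≡-mod-resp : ∀ {a a' b b' Q} → a ≈ a' → b ≈ b' → a ≡ b mod Q → a' ≡ b' mod Q
  ≡-mod-resp a≈a' b≈b' (h , a-b≈Qh) = h , trans (+-cong (sym a≈a') (-‿cong (sym b≈b'))) a-b≈Qh

  ≡-mod-+ : ∀ {a a' b b' Q} → a ≡ a' mod Q → b ≡ b' mod Q → a + b ≡ a' + b' mod Q
  ≡-mod-+ {a} {a'} {b} {b'} {Q} (u , a-a'≈Qu) (v , b-b'≈Qv) =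
    u + v , x≈y+z⇒x-y≈z (begin
      a + b                        ≈⟨ +-cong (x-y≈z⇒x≈y+z a-a'≈Qu) (x-y≈z⇒x≈y+z b-b'≈Qv) ⟩
      (a' + Q * u) + (b' + Q * v)  ≈⟨ solve 5 (λ a' b' Q u v →
                                         (a' :+ Q :* u) :+ (b' :+ Q :* v) := (a' :+ b') :+ Q :* (u :+ v))
                                         refl a' b' Q u v ⟩
      (a' + b') + Q * (u + v)      ∎)

  ≡-mod-* : ∀ {a a' b b' Q} → a ≡ a' mod Q → b ≡ b' mod Q → a * b ≡ a' * b' mod Q
  ≡-mod-* {a} {a'} {b} {b'} {Q} (u , a-a'≈Qu) (v , b-b'≈Qv) =
    a' * v + u * b' + Q * u * v , x≈y+z⇒x-y≈z (begin
      a * b                                  ≈⟨ *-cong (x-y≈z⇒x≈y+z a-a'≈Qu) (x-y≈z⇒x≈y+z b-b'≈Qv) ⟩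
      (a' + Q * u) * (b' + Q * v)            ≈⟨ solve 5 (λ a' b' Q u v →
                                                   (a' :+ Q :* u) :* (b' :+ Q :* v)
                                                   := a' :* b' :+ Q :* (a' :* v :+ u :* b' :+ Q :* u :* v))
                                                   refl a' b' Q u v ⟩
      a' * b' + Q * (a' * v + u * b' + Q * u * v)  ∎)

  ≡-mod-divisor : ∀ {a b Q Q'} r → Q' ≈ Q * r → a ≡ b mod Q' → a ≡ b mod Q
  ≡-mod-divisor {a} {b} {Q} {Q'} r Q'≈Qr (h , a-b≈Q'h) = r * h , (begin
    a - b        ≈⟨ a-b≈Q'h ⟩
    Q' * h       ≈⟨ *-congʳ Q'≈Qr ⟩
    Q * r * h    ≈⟨ *-assoc Q r h ⟩
    Q * (r * h)  ∎)

  private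
    N = ℕ→R R
    Z = ℤ→R R

  ℕ→R≡×1# : ∀ n → N n ≡.≡ n × 1#
  ℕ→R≡×1# ℕ.zero    = ≡.refl
  ℕ→R≡×1# (ℕ.suc n) = ≡.cong (_+_ 1#) (ℕ→R≡×1# n)

  ℕ→R-homo-+ : ∀ m n → N (m ℕ.+ n) ≈ N m + N n
  ℕ→R-homo-+ m n rewrite ℕ→R≡×1# (m ℕ.+ n) | ℕ→R≡×1# m | ℕ→R≡×1# n = ×-homo-+ 1# m n

  ℕ→R-homo-* : ∀ m n → N (m ℕ.* n) ≈ N m * N n
  ℕ→R-homo-* m n rewrite ℕ→R≡×1# (m ℕ.* n) | ℕ→R≡×1# m | ℕ→R≡×1# n = ×1-homo-* m n

  ℕ→R-∣ : ∀ {d e} → d ℕ∣.∣ e → ∃ λ h → N e ≈ N d * h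
  ℕ→R-∣ {d} {e} (divides q e≡qd) = N q , (begin
    N e           ≡⟨ ≡.cong N e≡qd ⟩
    N (q ℕ.* d)   ≈⟨ ℕ→R-homo-* q d ⟩
    N q * N d     ≈⟨ *-comm (N q) (N d) ⟩
    N d * N q     ∎)

  ≡-mod-∣ : ∀ {a b d e} → d ℕ∣.∣ e → a ≡ b mod N e → a ≡ b mod N d
  ≡-mod-∣ d∣e with ℕ→R-∣ d∣e
  ... | r , e≈dr = ≡-mod-divisor r e≈dr

  ℤ→R-homo-⊖ : ∀ m n → Z (m ℤ.⊖ n) ≈ N m - N n
  ℤ→R-homo-⊖ ℕ.zero    ℕ.zero    = sym (-‿inverseʳ 0#)
  ℤ→R-homo-⊖ ℕ.zero    (ℕ.suc n) = sym (+-identityˡ _)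
  ℤ→R-homo-⊖ (ℕ.suc m) ℕ.zero    = sym (trans (+-congˡ -0#≈0#) (+-identityʳ _))
  ℤ→R-homo-⊖ (ℕ.suc m) (ℕ.suc n) = begin
    Z (ℕ.suc m ℤ.⊖ ℕ.suc n)       ≡⟨ ≡.cong Z (ℤ.[1+m]⊖[1+n]≡m⊖n m n) ⟩
    Z (m ℤ.⊖ n)                   ≈⟨ ℤ→R-homo-⊖ m n ⟩
    N m - N n                     ≈⟨ +-congʳ (xyx⁻¹≈y 1# (N m)) ⟨
    ((1# + N m) - 1#) - N n       ≈⟨ +-assoc (1# + N m) (- 1#) (- N n) ⟩
    (1# + N m) + (- 1# + - N n)   ≈⟨ +-congˡ (-‿+-comm 1# (N n)) ⟩
    (1# + N m) - (1# + N n)       ∎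

  ℤ→R-homo-+ : ∀ x y → Z (x ℤ.+ y) ≈ Z x + Z y
  ℤ→R-homo-+ (+ m)      (+ n)      = ℕ→R-homo-+ m n
  ℤ→R-homo-+ (+ m)      ℤ.-[1+ n ] = ℤ→R-homo-⊖ m (ℕ.suc n)
  ℤ→R-homo-+ ℤ.-[1+ m ] (+ n)      = trans (ℤ→R-homo-⊖ n (ℕ.suc m)) (+-comm (N n) _)
  ℤ→R-homo-+ ℤ.-[1+ m ] ℤ.-[1+ n ] = begin
    - (1# + (1# + N (m ℕ.+ n)))    ≈⟨ -‿cong (+-congˡ (+-congˡ (ℕ→R-homo-+ m n))) ⟩
    - (1# + (1# + (N m + N n)))    ≈⟨ -‿cong (solve 3 (λ o x y →
                                         o :+ (o :+ (x :+ y)) := (o :+ x) :+ (o :+ y))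
                                         refl 1# (N m) (N n)) ⟩
    - ((1# + N m) + (1# + N n))    ≈⟨ -‿+-comm (1# + N m) (1# + N n) ⟨
    - (1# + N m) + - (1# + N n)    ∎

  ℤ→R-homo-neg : ∀ x → Z (ℤ.- x) ≈ - Z x
  ℤ→R-homo-neg (+ ℕ.zero)    = sym -0#≈0#
  ℤ→R-homo-neg (+ ℕ.suc n)   = refl
  ℤ→R-homo-neg ℤ.-[1+ n ]    = sym (-‿involutive _)

  ℤ→R-homo-- : ∀ x y → Z (x ℤ.- y) ≈ Z x - Z y
  ℤ→R-homo-- x y = trans (ℤ→R-homo-+ x (ℤ.- y)) (+-congˡ (ℤ→R-homo-neg y))

  ℤ→R-∣ : ∀ {d} z → + d ∣ z → ∃ λ h → Z z ≈ N d * h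
  ℤ→R-∣ (+ n)      d∣n = ℕ→R-∣ d∣n
  ℤ→R-∣ {d} ℤ.-[1+ n ] d∣n with ℕ→R-∣ d∣n
  ... | h , n≈dh = - h , trans (-‿cong n≈dh) (-‿distribʳ-* (N d) h)

  ℤ→R-cong : ∀ {d} k k' → + d ∣ k ℤ.- k' → Z k ≡ Z k' mod N d
  ℤ→R-cong k k' d∣k-k' with ℤ→R-∣ (k ℤ.- k') d∣k-k'
  ... | h , k-k'≈dh = h , trans (sym (ℤ→R-homo-- k k')) k-k'≈dh

  δ-cong : ∀ {Q} k k' (f f' : QExp R) → Z k ≡ Z k' mod Q → (∀ i j → f i j ≡ f' i j mod Q) →
           ∀ i j → δ R k f i j ≡ δ R k' f' i j mod Q
  δ-cong k k' f f' k≡k' f≡f' ℕ.zero    j = ≡-mod-* ≡-mod-refl (f≡f' 0 j)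
  δ-cong {Q} k k' f f' k≡k' f≡f' (ℕ.suc i) j =
    ≡-mod-+ (≡-mod-* ≡-mod-refl (f≡f' (ℕ.suc i) j)) (≡-mod-* k-i≡k'-i (f≡f' i j))
    where
    k-i≡k'-i : Z (k ℤ.- + i) ≡ Z (k' ℤ.- + i) mod Q
    k-i≡k'-i = ≡-mod-resp (sym (ℤ→R-homo-+ k _)) (sym (ℤ→R-homo-+ k' _)) (≡-mod-+ k≡k' ≡-mod-refl)

proposition4p6 : ∀ {c ℓ : Level} (R : CommutativeRing c ℓ)
    (NearlyHolomorphic : ℤ → QExp R → Set (c ⊔ ℓ))
    (p : ℕ) → Prime p → (n m : ℕ) (k k' : ℤ) →
    (+ (p ^ n ℕ.* (p ∸ 1))) ∣ (k ℤ.- k') →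
    (f f' : QExp R) →
    NearlyHolomorphic k f → NearlyHolomorphic k' f' →
    IsPolynomialInX R f → IsPolynomialInX R f' →
    CongMod R p m f f' →
    CongMod R p (n ⊓ m) (δ R k f) (δ R k' f')
proposition4p6 R _ p _ n m k k' pⁿ⁽ᵖ⁻¹⁾∣k-k' f f' _ _ _ _ f≡f' =
  δ-cong R k k' f f' (≡-mod-∣ R p^n⊓m∣pⁿ⁽ᵖ⁻¹⁾ (ℤ→R-cong R k k' pⁿ⁽ᵖ⁻¹⁾∣k-k'))
           (λ i j → ≡-mod-∣ R (m≤n⇒o^m∣o^n p (ℕ.m⊓n≤n n m)) (f≡f' i j))
  where
  p^n⊓m∣pⁿ⁽ᵖ⁻¹⁾ : p ^ (n ⊓ m) ℕ∣.∣ p ^ n ℕ.* (p ∸ 1)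
  p^n⊓m∣pⁿ⁽ᵖ⁻¹⁾ = ℕ∣.∣-trans (m≤n⇒o^m∣o^n p (ℕ.m⊓n≤m n m)) (ℕ∣.m∣m*n (p ∸ 1))
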